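{- For every $n\ge 2$, $R_n^{(3\le\max,\emptyset,0,0)}(0)=2\,c(n,2)$, where $c(n,2)$ is the number of permutations of $\{1,\dots,n\}$ having exactly two cycles.
   Context: For $\sigma=\sigma_1\cdots\sigma_n\in S_n$, $\sigma_i$ matches $MMP(3\le\max,\emptyset,0,0)$ if no $j<i$ has $\sigma_j>\sigma_i$, and, with $\sigma_m=\max\{\sigma_{i+1},\dots,\sigma_n\}$ ($i<n$), at least $3$ of $\sigma_{i+1},\dots,\sigma_m$ are greater than $\sigma_i$. $mmp^{(3\le\max,\emptyset,0,0)}(\sigma)$ is the number of such $i$, and $R_n^{(3\le\max,\emptyset,0,0)}(x)=\sum_{\sigma\in S_n}x^{mmp^{(3\le\max,\emptyset,0,0)}(\sigma)}$; thus $R_n^{(3\le\max,\emptyset,0,0)}(0)$ is the number of $\sigma\in S_n$ with no such $i$. -}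

module Defs where

open import Data.Bool using (Bool; true; false; _∧_; not; if_then_else_)
open import Data.Nat using (ℕ; zero; suc; _+_; _≤ᵇ_; _<ᵇ_; _≡ᵇ_; _⊔_)
open import Data.Fin using (Fin; toℕ)
open import Data.List using (List; []; _∷_; [_]; map; concatMap; length; filter; allFin; foldr; _++_)
open import Data.Vec using (Vec; []; _∷_; lookup; toList)
open import Data.Bool.ListAction using (any; all)
open import Relation.Nullary.Decidable using (does)
open import Data.Bool.Properties using (T?)

-- Permutations of an n-element set {0,…,n-1} (0-based version of {1,…,n})
-- in one-line notation: σ = σ₀ σ₁ … σₙ₋₁ as a vector of values in Fin n.

allVecs : (n k : ℕ) → List (Vec (Fin n) k)
allVecs n zero    = [ [] ]
allVecs n (suc k) = concatMap (λ a → map (a ∷_) (allVecs n k)) (allFin n)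

distinct : List ℕ → Bool
distinct []       = true
distinct (x ∷ xs) = not (any (x ≡ᵇ_) xs) ∧ distinct xs

-- a map Fin n → Fin n is a permutation iff it is injective
isPerm : ∀ {n} → Vec (Fin n) n → Bool
isPerm σ = distinct (map toℕ (toList σ))

Sym : (n : ℕ) → List (Vec (Fin n) n)
Sym n = filter (λ σ → T? (isPerm σ)) (allVecs n n)

countB : ∀ {A : Set} → (A → Bool) → List A → ℕ
countB p xs = length (filter (λ x → T? (p x)) xs)

maxList : List ℕ → ℕ
maxList = foldr _⊔_ 0

takeThrough : ℕ → List ℕ → List ℕ
takeThrough m []       = []
takeThrough m (y ∷ ys) = y ∷ (if y ≡ᵇ m then [] else takeThrough m ys)

-- position i (entry x, earlier entries pre, later entries post) matches
-- MMP(3≤max,∅,0,0): no earlier entry exceeds x, i < n (post nonempty), and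
-- at least 3 of σ_{i+1},…,σ_m (σ_m = max of post) exceed x.
matchesAt : List ℕ → ℕ → List ℕ → Bool
matchesAt pre x []         = false
matchesAt pre x post@(_ ∷ _) =
  all (λ y → y ≤ᵇ x) pre ∧ (3 ≤ᵇ countB (λ y → x <ᵇ y) (takeThrough (maxList post) post))

mmpAux : List ℕ → List ℕ → ℕ
mmpAux pre []         = 0
mmpAux pre (x ∷ post) = (if matchesAt pre x post then 1 else 0) + mmpAux (pre ++ [ x ]) post

mmp : List ℕ → ℕ
mmp = mmpAux []

mmpPerm : ∀ {n} → Vec (Fin n) n → ℕ
mmpPerm σ = mmp (map toℕ (toList σ))

R0 : ℕ → ℕ
R0 n = countB (λ σ → mmpPerm σ ≡ᵇ 0) (Sym n)

iter : ∀ {n} → Vec (Fin n) n → ℕ → Fin n → Fin n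
iter σ zero    i = i
iter σ (suc k) i = lookup σ (iter σ k i)

-- the elements σ^1(i), …, σ^n(i)  (this is the whole cycle of i)
orbit : ∀ {n} → Vec (Fin n) n → Fin n → List (Fin n)
orbit {n} σ i = map (λ k → iter σ (suc (toℕ k)) i) (allFin n)

isCycleMin : ∀ {n} → Vec (Fin n) n → Fin n → Bool
isCycleMin σ i = all (λ j → toℕ i ≤ᵇ toℕ j) (orbit σ i)

numCycles : ∀ {n} → Vec (Fin n) n → ℕ
numCycles {n} σ = countB (isCycleMin σ) (allFin n)

c : ℕ → ℕ → ℕ
c n k = countB (λ σ → numCycles σ ≡ᵇ k) (Sym n)

module Submission where

-- Remove the entry 0 from σ ∈ S(n+1), leaving τ ∈ S(n). Re-inserted at a position k ≥ 1, the
-- 0 is neither a left-to-right maximum nor larger than any entry, so matches are unchanged;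
-- inserted in front it is a match exactly when the maximum of τ sits at position ≥ 3, and when
-- the maximum sits at position ≤ 2, τ itself has no match. Hence R(n+1) = M₂(n) + n R(n), where
-- M₁(n) and M₂(n) count the permutations whose maximum is first, resp. among the first two.
-- Following the position of the maximum through the same insertion gives M₁(n+1) = n M₁(n) and
-- M₂(n+1) = 2 M₁(n) + (n-1) M₂(n). On the cycle side, adding the new largest element n either as
-- a fixed point or right after some k in its cycle gives c(n+1,j) = c(n,j-1) + n c(n,j). By
-- induction M₁(n) = c(n,1), M₂(n) = 2 c(n,1) for n ≥ 2, and finally R(n) = 2 c(n,2).

open import Defs
open import Data.Bool using (Bool; true; false; not; _∧_; if_then_else_; T)
open import Data.Bool.ListAction using (any; all)
open import Data.Bool.Properties using (T?; T-∧; T-∨; T-≡; ∧-zeroʳ)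
open import Data.Empty using (⊥-elim)
open import Data.Fin as Fin using (Fin; toℕ; fromℕ; inject₁; punchIn; punchOut)
  renaming (zero to fzero; suc to fsuc)
import Data.Fin.Properties as Finₚ
open import Data.Fin.Properties using (toℕ-injective; any?; pigeonhole; injective⇒≤; punchOut-injective; punchIn-punchOut; punchInᵢ≢i; punchIn-injective; fromℕ≢inject₁; inject₁-injective; inject₁-lower₁; toℕ<n; toℕ-fromℕ<; toℕ-inject₁; toℕ-fromℕ; toℕ≤pred[n]; ≤fromℕ)
open import Data.List using (List; []; _∷_; [_]; map; length; allFin; _++_; cartesianProductWith)
open import Data.List.Properties using (map-tabulate; length-tabulate; length-map)
open import Data.List.Membership.Propositional using (_∈_)
open import Data.List.Membership.Propositional.Properties using (∈-cartesianProductWith⁺; ∈-cartesianProductWith⁻; ∈-filter⁺; ∈-filter⁻; ∈-allFin; ∈-map⁺; ∈-map⁻)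
open import Data.List.Membership.Propositional.Properties.WithK using (unique∧set⇒bag)
open import Data.List.Relation.Binary.BagAndSetEquality using (∼bag⇒↭)
open import Data.List.Relation.Binary.Permutation.Propositional using (_↭_)
open import Data.List.Relation.Binary.Permutation.Propositional.Properties using (↭-length; filter-↭)
open import Data.List.Relation.Unary.All as All using (All; []; _∷_)
open import Data.List.Relation.Unary.All.Properties using (all⁺; all⁻)
open import Data.List.Relation.Unary.Any using (here; there)
open import Data.List.Relation.Unary.AllPairs using ([]; _∷_)
open import Data.List.Relation.Unary.Unique.Propositional using (Unique)
open import Data.List.Relation.Unary.Unique.Propositional.Properties using (cartesianProductWith⁺; filter⁺; allFin⁺; map⁺)
open import Data.Nat using (ℕ; zero; suc; _+_; _*_; _≤_; _<_; _≤?_; _⊔_; _≤ᵇ_; _<ᵇ_; _≡ᵇ_; z≤n; s≤s)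
open import Data.Nat.ListAction using (sum)
open import Data.Nat.Properties
open import Data.Sum using (_⊎_; inj₁; inj₂)
open import Data.Maybe using (Maybe; just; nothing; is-nothing)
open import Data.Maybe.Properties using (just-injective)
open import Data.Product using (∃; ∃₂; _×_; _,_; proj₁; proj₂)
open import Data.Vec as Vec using (Vec; lookup; tabulate; toList; insertAt; removeAt)
open import Data.Vec.Properties using (∷-injective; ∷-injectiveˡ; ∷-injectiveʳ; tabulate∘lookup; tabulate-cong; lookup∘tabulate; lookup-map; insertAt-lookup; insertAt-punchIn; insertAt-removeAt)
open import Function using (_∘_; id; case_of_; _⇔_; mk⇔; Equivalence)
open import Function.Definitions using (Injective)
open import Relation.Nullary using (yes; no; contradiction)
open import Relation.Binary.PropositionalEquality hiding ([_])
open import Data.Nat.Solver using (module +-*-Solver)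
open +-*-Solver using (solve; _:+_; _:*_; _:=_; con)

ind : Bool → ℕ
ind b = if b then 1 else 0

∑ : ∀ {A : Set} → (A → ℕ) → List A → ℕ
∑ f xs = sum (map f xs)

module _ {A : Set} where

  countB-∷ : (p : A → Bool) (x : A) (xs : List A) → countB p (x ∷ xs) ≡ ind (p x) + countB p xs
  countB-∷ p x xs with p x
  ... | true  = refl
  ... | false = refl

  countB-++ : (p : A → Bool) (xs ys : List A) → countB p (xs ++ ys) ≡ countB p xs + countB p ys
  countB-++ p []       ys = refl
  countB-++ p (x ∷ xs) ys = begin
    countB p (x ∷ xs ++ ys)                    ≡⟨ countB-∷ p x (xs ++ ys) ⟩
    ind (p x) + countB p (xs ++ ys)            ≡⟨ cong (ind (p x) +_) (countB-++ p xs ys) ⟩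
    ind (p x) + (countB p xs + countB p ys)    ≡⟨ +-assoc (ind (p x)) _ _ ⟨
    ind (p x) + countB p xs + countB p ys      ≡⟨ cong (_+ countB p ys) (countB-∷ p x xs) ⟨
    countB p (x ∷ xs) + countB p ys            ∎
    where open ≡-Reasoning

  countB-cong : {p q : A → Bool} → (∀ x → p x ≡ q x) → (xs : List A) → countB p xs ≡ countB q xs
  countB-cong {p} {q} p≗q []       = refl
  countB-cong {p} {q} p≗q (x ∷ xs) =
    trans (countB-∷ p x xs) (trans (cong₂ _+_ (cong ind (p≗q x)) (countB-cong p≗q xs)) (sym (countB-∷ q x xs)))

  countB-↭ : (p : A → Bool) {xs ys : List A} → xs ↭ ys → countB p xs ≡ countB p ys
  countB-↭ p xs↭ys = ↭-length (filter-↭ (T? ∘ p) xs↭ys)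

  countB-const : (p : A → Bool) (b : Bool) → (∀ x → p x ≡ b) → (xs : List A) → countB p xs ≡ length xs * ind b
  countB-const p b p≗b []       = refl
  countB-const p b p≗b (x ∷ xs) =
    trans (countB-∷ p x xs) (cong₂ _+_ (cong ind (p≗b x)) (countB-const p b p≗b xs))

  ∑-cong∈ : {f g : A → ℕ} (xs : List A) → (∀ {x} → x ∈ xs → f x ≡ g x) → ∑ f xs ≡ ∑ g xs
  ∑-cong∈ []       f≗g = refl
  ∑-cong∈ (x ∷ xs) f≗g = cong₂ _+_ (f≗g (here refl)) (∑-cong∈ xs (f≗g ∘ there))

  ∑-linear : (a b : ℕ) (p q : A → Bool) (xs : List A) →
             ∑ (λ x → a * ind (p x) + b * ind (q x)) xs ≡ a * countB p xs + b * countB q xs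
  ∑-linear a b p q []       = sym (cong₂ _+_ (*-zeroʳ a) (*-zeroʳ b))
  ∑-linear a b p q (x ∷ xs) = begin
    a * ind (p x) + b * ind (q x) + ∑ (λ y → a * ind (p y) + b * ind (q y)) xs
      ≡⟨ cong (a * ind (p x) + b * ind (q x) +_) (∑-linear a b p q xs) ⟩
    a * ind (p x) + b * ind (q x) + (a * countB p xs + b * countB q xs)
      ≡⟨ regroup a b (ind (p x)) (ind (q x)) (countB p xs) (countB q xs) ⟩
    a * (ind (p x) + countB p xs) + b * (ind (q x) + countB q xs)
      ≡⟨ cong₂ (λ u v → a * u + b * v) (countB-∷ p x xs) (countB-∷ q x xs) ⟨
    a * countB p (x ∷ xs) + b * countB q (x ∷ xs)
      ∎
    where
    open ≡-Reasoning
    regroup : ∀ a b u v s t → a * u + b * v + (a * s + b * t) ≡ a * (u + s) + b * (v + t)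
    regroup = solve 6 (λ a b u v s t → a :* u :+ b :* v :+ (a :* s :+ b :* t) := a :* (u :+ s) :+ b :* (v :+ t)) refl

countB-map : ∀ {A B : Set} (p : B → Bool) (f : A → B) (xs : List A) → countB p (map f xs) ≡ countB (p ∘ f) xs
countB-map p f []       = refl
countB-map p f (x ∷ xs) = trans (countB-∷ p (f x) (map f xs))
  (trans (cong (ind (p (f x)) +_) (countB-map p f xs)) (sym (countB-∷ (p ∘ f) x xs)))

countB-cartesianProductWith : ∀ {A B C : Set} (p : C → Bool) (g : A → B → C) (xs : List A) (ys : List B) →
  countB p (cartesianProductWith g xs ys) ≡ ∑ (λ x → countB (p ∘ g x) ys) xs
countB-cartesianProductWith p g []       ys = refl
countB-cartesianProductWith p g (x ∷ xs) ys = trans (countB-++ p (map (g x) ys) _)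
  (cong₂ _+_ (countB-map p (g x) ys) (countB-cartesianProductWith p g xs ys))

countB-allFin-const : ∀ {n} (p : Fin n → Bool) (b : Bool) → (∀ k → p k ≡ b) → countB p (allFin n) ≡ n * ind b
countB-allFin-const {n} p b p≗b = trans (countB-const p b p≗b (allFin n)) (cong (_* ind b) (length-tabulate {n = n} id))

countB-allFin-suc : ∀ {n} (p : Fin (suc n) → Bool) → countB p (allFin (suc n)) ≡ ind (p fzero) + countB (p ∘ fsuc) (allFin n)
countB-allFin-suc {n} p = trans (countB-∷ p fzero _)
  (cong (ind (p fzero) +_) (trans (cong (countB p) (sym (map-tabulate id fsuc))) (countB-map p fsuc (allFin n))))

countB-allFin-last : ∀ {n} (p : Fin (suc n) → Bool) →
  countB p (allFin (suc n)) ≡ countB (p ∘ inject₁) (allFin n) + ind (p (fromℕ n))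
countB-allFin-last {zero}  p = trans (countB-∷ p fzero []) (+-comm (ind (p fzero)) 0)
countB-allFin-last {suc n} p = begin
  countB p (allFin (suc (suc n)))
    ≡⟨ countB-allFin-suc p ⟩
  ind (p fzero) + countB (p ∘ fsuc) (allFin (suc n))
    ≡⟨ cong (ind (p fzero) +_) (countB-allFin-last (p ∘ fsuc)) ⟩
  ind (p fzero) + (countB (p ∘ fsuc ∘ inject₁) (allFin n) + ind (p (fromℕ (suc n))))
    ≡⟨ +-assoc (ind (p fzero)) _ _ ⟨
  ind (p fzero) + countB (p ∘ inject₁ ∘ fsuc) (allFin n) + ind (p (fromℕ (suc n)))
    ≡⟨ cong (_+ ind (p (fromℕ (suc n)))) (countB-allFin-suc (p ∘ inject₁)) ⟨
  countB (p ∘ inject₁) (allFin (suc n)) + ind (p (fromℕ (suc n)))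
    ∎
  where open ≡-Reasoning

allVecs-suc : ∀ n k → allVecs n (suc k) ≡ cartesianProductWith Vec._∷_ (allFin n) (allVecs n k)
allVecs-suc n k = go (allFin n)
  where
  go : ∀ xs → Data.List.concatMap (λ a → map (a Vec.∷_) (allVecs n k)) xs ≡ cartesianProductWith Vec._∷_ xs (allVecs n k)
  go []       = refl
  go (x ∷ xs) = cong (map (x Vec.∷_) (allVecs n k) ++_) (go xs)

allVecs-unique : ∀ n k → Unique (allVecs n k)
allVecs-unique n zero    = [] ∷ []
allVecs-unique n (suc k) rewrite allVecs-suc n k =
  cartesianProductWith⁺ Vec._∷_ ∷-injective (allFin⁺ n) (allVecs-unique n k)

∈-allVecs : ∀ n k (v : Vec (Fin n) k) → v ∈ allVecs n k
∈-allVecs n zero    Vec.[]      = here refl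
∈-allVecs n (suc k) (x Vec.∷ v) rewrite allVecs-suc n k =
  ∈-cartesianProductWith⁺ Vec._∷_ (∈-allFin x) (∈-allVecs n k v)

Sym-unique : ∀ n → Unique (Sym n)
Sym-unique n = filter⁺ (T? ∘ isPerm) (allVecs-unique n n)

∈-Sym⁺ : ∀ {n} {σ : Vec (Fin n) n} → T (isPerm σ) → σ ∈ Sym n
∈-Sym⁺ {n} {σ} = ∈-filter⁺ (T? ∘ isPerm) (∈-allVecs n n σ)

∈-Sym⁻ : ∀ {n} {σ : Vec (Fin n) n} → σ ∈ Sym n → T (isPerm σ)
∈-Sym⁻ {n} = proj₂ ∘ ∈-filter⁻ (T? ∘ isPerm) {xs = allVecs n n}

record Parametrisation (n : ℕ) (C : Set) : Set where
  field
    extend      : Vec (Fin n) n → C → Vec (Fin (suc n)) (suc n)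
    codes       : List C
    codes-unique : Unique codes
    extend-injective : ∀ {τ τ′ c c′} → extend τ c ≡ extend τ′ c′ → τ ≡ τ′ × c ≡ c′
    extend-isPerm    : ∀ {τ} c → T (isPerm τ) → T (isPerm (extend τ c))
    extend-surjective : ∀ {σ} → T (isPerm σ) → ∃₂ λ τ c → T (isPerm τ) × c ∈ codes × σ ≡ extend τ c

countB-Sym-suc : ∀ {n C} (P : Parametrisation n C) (p : Vec (Fin (suc n)) (suc n) → Bool) →
  countB p (Sym (suc n)) ≡ ∑ (λ τ → countB (p ∘ Parametrisation.extend P τ) (Parametrisation.codes P)) (Sym n)
countB-Sym-suc {n} P p = trans (countB-↭ p Sym↭image) (countB-cartesianProductWith p extend (Sym n) codes)
  where
  open Parametrisation P
  image : List (Vec (Fin (suc n)) (suc n))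
  image = cartesianProductWith extend (Sym n) codes
  same-elements : ∀ {σ} → σ ∈ Sym (suc n) ⇔ σ ∈ image
  same-elements = mk⇔ to from
    where
    to : ∀ {σ} → σ ∈ Sym (suc n) → σ ∈ image
    to {σ} σ∈ with extend-surjective {σ} (∈-Sym⁻ σ∈)
    ... | τ , c , τ-perm , c∈ , refl = ∈-cartesianProductWith⁺ extend (∈-Sym⁺ τ-perm) c∈
    from : ∀ {σ} → σ ∈ image → σ ∈ Sym (suc n)
    from σ∈ with ∈-cartesianProductWith⁻ extend (Sym n) codes σ∈
    ... | τ , c , τ∈ , c∈ , refl = ∈-Sym⁺ (extend-isPerm c (∈-Sym⁻ τ∈))
  Sym↭image : Sym (suc n) ↭ image
  Sym↭image = ∼bag⇒↭ (unique∧set⇒bag (Sym-unique (suc n))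
    (cartesianProductWith⁺ extend extend-injective (Sym-unique n) codes-unique) same-elements)

entries : ∀ {n m} → Vec (Fin n) m → List ℕ
entries v = map toℕ (toList v)

module _ {n : ℕ} (x : Fin n) where

  occurs⁺ : ∀ {m} (w : Vec (Fin n) m) j → lookup w j ≡ x → T (any (toℕ x ≡ᵇ_) (entries w))
  occurs⁺ (y Vec.∷ w) fzero    refl = Equivalence.from T-∨ (inj₁ (≡⇒≡ᵇ (toℕ y) (toℕ y) refl))
  occurs⁺ (y Vec.∷ w) (fsuc j) wj≡x = Equivalence.from T-∨ (inj₂ (occurs⁺ w j wj≡x))

  occurs⁻ : ∀ {m} (w : Vec (Fin n) m) → T (any (toℕ x ≡ᵇ_) (entries w)) → ∃ λ j → lookup w j ≡ x
  occurs⁻ (y Vec.∷ w) h with toℕ x ≡ᵇ toℕ y | ≡ᵇ⇒≡ (toℕ x) (toℕ y)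
  ... | true  | x≡y = fzero , sym (toℕ-injective (x≡y _))
  ... | false | _   = let j , wj≡x = occurs⁻ w h in fsuc j , wj≡x

distinct-∷⇒∉ : ∀ {n m} (x : Fin n) (w : Vec (Fin n) m) → T (distinct (entries (x Vec.∷ w))) → ∀ j → lookup w j ≢ x
distinct-∷⇒∉ x w h j wj≡x with any (toℕ x ≡ᵇ_) (entries w) | occurs⁺ x w j wj≡x
... | true | _ = h

distinct⇒injective : ∀ {n m} (v : Vec (Fin n) m) → T (distinct (entries v)) → Injective _≡_ _≡_ (lookup v)
distinct⇒injective (x Vec.∷ w) h {fzero}  {fzero}  _ = refl
distinct⇒injective (x Vec.∷ w) h {fzero}  {fsuc j} e = ⊥-elim (distinct-∷⇒∉ x w h j (sym e))
distinct⇒injective (x Vec.∷ w) h {fsuc i} {fzero}  e = ⊥-elim (distinct-∷⇒∉ x w h i e)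
distinct⇒injective (x Vec.∷ w) h {fsuc i} {fsuc j} e =
  cong fsuc (distinct⇒injective w (proj₂ (Equivalence.to T-∧ h)) e)

injective⇒distinct : ∀ {n m} (v : Vec (Fin n) m) → Injective _≡_ _≡_ (lookup v) → T (distinct (entries v))
injective⇒distinct Vec.[]      _   = _
injective⇒distinct (x Vec.∷ w) inj = Equivalence.from T-∧ (fresh , injective⇒distinct w (Finₚ.suc-injective ∘ inj))
  where
  fresh : T (not (any (toℕ x ≡ᵇ_) (entries w)))
  fresh with any (toℕ x ≡ᵇ_) (entries w) in x∈w
  ... | false = _
  ... | true  = let j , wj≡x = occurs⁻ x w (Equivalence.from T-≡ x∈w) in Finₚ.0≢1+n (inj (sym wj≡x))

-- If y were missed, punching y out of the codomain would inject Fin (suc n) into Fin n.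
injective⇒surjective : ∀ {n} {f : Fin n → Fin n} → Injective _≡_ _≡_ f → ∀ y → ∃ λ x → f x ≡ y
injective⇒surjective {zero}          _   ()
injective⇒surjective {suc n} {f} inj y with any? (λ x → f x Fin.≟ y)
... | yes hit = hit
... | no miss = ⊥-elim (n≮n n (injective⇒≤ {f = λ x → punchOut (avoids x)} (inj ∘ punchOut-injective (avoids _) (avoids _))))
  where
  avoids : ∀ x → y ≢ f x
  avoids x y≡fx = miss (x , sym y≡fx)

module _ {A : Set} {n : ℕ} (v : Vec A n) (k : Fin (suc n)) (a : A) where

  lookup-insertAt : ∀ i → (i ≡ k × lookup (insertAt v k a) i ≡ a)
                        ⊎ (∃ λ j → i ≡ punchIn k j × lookup (insertAt v k a) i ≡ lookup v j)
  lookup-insertAt i with i Fin.≟ k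
  ... | yes refl = inj₁ (refl , insertAt-lookup v k a)
  ... | no i≢k   = inj₂ (punchOut k≢i , sym (punchIn-punchOut k≢i) ,
                         trans (cong (lookup (insertAt v k a)) (sym (punchIn-punchOut k≢i))) (insertAt-punchIn v k a _))
    where k≢i = i≢k ∘ sym

  insertAt-injective : Injective _≡_ _≡_ (lookup v) → (∀ j → lookup v j ≢ a) → Injective _≡_ _≡_ (lookup (insertAt v k a))
  insertAt-injective inj fresh {i} {i′} e with lookup-insertAt i | lookup-insertAt i′
  ... | inj₁ (refl , _)      | inj₁ (refl , _)        = refl
  ... | inj₁ (_ , vi≡a)      | inj₂ (j , _ , vi′≡vj)  = ⊥-elim (fresh j (trans (sym vi′≡vj) (trans (sym e) vi≡a)))
  ... | inj₂ (j , _ , vi≡vj) | inj₁ (_ , vi′≡a)       = ⊥-elim (fresh j (trans (sym vi≡vj) (trans e vi′≡a)))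
  ... | inj₂ (j , refl , vi≡vj) | inj₂ (j′ , refl , vi′≡vj′) =
    cong (punchIn k) (inj (trans (sym vi≡vj) (trans e vi′≡vj′)))

map-fsuc-injective : ∀ {n m} {w x : Vec (Fin n) m} → Vec.map fsuc w ≡ Vec.map fsuc x → w ≡ x
map-fsuc-injective {w = Vec.[]}    {Vec.[]}    _ = refl
map-fsuc-injective {w = a Vec.∷ w} {b Vec.∷ x} e =
  cong₂ Vec._∷_ (Finₚ.suc-injective (∷-injectiveˡ e)) (map-fsuc-injective (∷-injectiveʳ e))

nonzero⇒map-fsuc : ∀ {n m} (v : Vec (Fin (suc n)) m) → (∀ j → lookup v j ≢ fzero) → ∃ λ w → v ≡ Vec.map fsuc w
nonzero⇒map-fsuc Vec.[]             _       = Vec.[] , refl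
nonzero⇒map-fsuc (fzero Vec.∷ v)    nonzero = ⊥-elim (nonzero fzero refl)
nonzero⇒map-fsuc (fsuc x Vec.∷ v)   nonzero =
  let w , v≡ = nonzero⇒map-fsuc v (nonzero ∘ fsuc) in x Vec.∷ w , cong (fsuc x Vec.∷_) v≡

insertMin : ∀ {n} → Vec (Fin n) n → Fin (suc n) → Vec (Fin (suc n)) (suc n)
insertMin τ k = insertAt (Vec.map fsuc τ) k fzero

insertMin-injective : ∀ {n m} {τ τ′ : Vec (Fin n) m} {k k′ : Fin (suc m)} →
  insertAt (Vec.map fsuc τ) k fzero ≡ insertAt (Vec.map fsuc τ′) k′ fzero → τ ≡ τ′ × k ≡ k′
insertMin-injective {k = fzero} {fzero} e = map-fsuc-injective (∷-injectiveʳ e) , refl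
insertMin-injective {τ′ = _ Vec.∷ _} {k = fzero} {fsuc k′} e = ⊥-elim (Finₚ.0≢1+n (∷-injectiveˡ e))
insertMin-injective {τ = _ Vec.∷ _} {k = fsuc k} {fzero} e = ⊥-elim (Finₚ.0≢1+n (sym (∷-injectiveˡ e)))
insertMin-injective {τ = a Vec.∷ τ} {b Vec.∷ τ′} {fsuc k} {fsuc k′} e
  with insertMin-injective {τ = τ} {τ′} {k} {k′} (∷-injectiveʳ e)
... | refl , refl = cong (Vec._∷ τ) (Finₚ.suc-injective (∷-injectiveˡ e)) , refl

lookup-map-fsuc-injective : ∀ {n m} (τ : Vec (Fin n) m) →
  Injective _≡_ _≡_ (lookup τ) → Injective _≡_ _≡_ (lookup (Vec.map fsuc τ))
lookup-map-fsuc-injective τ inj {i} {j} e = inj (Finₚ.suc-injective (trans (sym (lookup-map i fsuc τ)) (trans e (lookup-map j fsuc τ))))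

insertMin-isPerm : ∀ {n} {τ : Vec (Fin n) n} k → T (isPerm τ) → T (isPerm (insertMin τ k))
insertMin-isPerm {τ = τ} k τ-perm = injective⇒distinct (insertMin τ k)
  (insertAt-injective (Vec.map fsuc τ) k fzero (lookup-map-fsuc-injective τ (distinct⇒injective τ τ-perm))
    λ j e → Finₚ.0≢1+n (trans (sym e) (lookup-map j fsuc τ)))

insertMin-surjective : ∀ {n} {σ : Vec (Fin (suc n)) (suc n)} → T (isPerm σ) →
  ∃₂ λ τ k → T (isPerm τ) × k ∈ allFin (suc n) × σ ≡ insertMin τ k
insertMin-surjective {n} {σ} σ-perm = τ , k , injective⇒distinct τ τ-injective , ∈-allFin k , σ≡
  where
  σ-injective = distinct⇒injective σ σ-perm
  k = proj₁ (injective⇒surjective σ-injective fzero)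
  σk≡0 = proj₂ (injective⇒surjective σ-injective fzero)
  ρ = removeAt σ k
  ρ-fills-σ : insertAt ρ k fzero ≡ σ
  ρ-fills-σ = subst (λ a → insertAt ρ k a ≡ σ) σk≡0 (insertAt-removeAt σ k)
  ρ-entry : ∀ j → lookup ρ j ≡ lookup σ (punchIn k j)
  ρ-entry j = trans (sym (insertAt-punchIn ρ k fzero j)) (cong (λ v → lookup v (punchIn k j)) ρ-fills-σ)
  ρ-nonzero : ∀ j → lookup ρ j ≢ fzero
  ρ-nonzero j e = punchInᵢ≢i k j (σ-injective (trans (sym (ρ-entry j)) (trans e (sym σk≡0))))
  τ = proj₁ (nonzero⇒map-fsuc ρ ρ-nonzero)
  ρ≡ = proj₂ (nonzero⇒map-fsuc ρ ρ-nonzero)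
  τ-injective : Injective _≡_ _≡_ (lookup τ)
  τ-injective {i} {j} e = punchIn-injective k i j (σ-injective (begin
    lookup σ (punchIn k i)        ≡⟨ ρ-entry i ⟨
    lookup ρ i                    ≡⟨ cong (λ v → lookup v i) ρ≡ ⟩
    lookup (Vec.map fsuc τ) i     ≡⟨ lookup-map i fsuc τ ⟩
    fsuc (lookup τ i)             ≡⟨ cong fsuc e ⟩
    fsuc (lookup τ j)             ≡⟨ lookup-map j fsuc τ ⟨
    lookup (Vec.map fsuc τ) j     ≡⟨ cong (λ v → lookup v j) ρ≡ ⟨
    lookup ρ j                    ≡⟨ ρ-entry j ⟩
    lookup σ (punchIn k j)        ∎))
    where open ≡-Reasoning
  σ≡ : σ ≡ insertMin τ k
  σ≡ = trans (sym ρ-fills-σ) (cong (λ v → insertAt v k fzero) ρ≡)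

insertMin-parametrisation : ∀ n → Parametrisation n (Fin (suc n))
insertMin-parametrisation n = record
  { extend            = insertMin
  ; codes             = allFin (suc n)
  ; codes-unique      = allFin⁺ (suc n)
  ; extend-injective  = insertMin-injective
  ; extend-isPerm     = insertMin-isPerm
  ; extend-surjective = insertMin-surjective
  }

data LastView {n : ℕ} : Fin (suc n) → Set where
  last   : LastView (fromℕ n)
  inject : (j : Fin n) → LastView (inject₁ j)

lastView : ∀ {n} (i : Fin (suc n)) → LastView i
lastView {zero}  fzero    = last
lastView {suc n} fzero    = inject fzero
lastView {suc n} (fsuc i) with lastView i
... | last     = last
... | inject j = inject (fsuc j)

lastView-fromℕ : ∀ n → lastView (fromℕ n) ≡ last
lastView-fromℕ zero    = refl
lastView-fromℕ (suc n) rewrite lastView-fromℕ n = refl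

lastView-inject₁ : ∀ {n} (j : Fin n) → lastView (inject₁ j) ≡ inject j
lastView-inject₁ {suc n} fzero    = refl
lastView-inject₁ {suc n} (fsuc j) rewrite lastView-inject₁ j = refl

-- nothing: n becomes a fixed point; just k: n is inserted into the cycle of k, right after k.
insertMaxAt : ∀ {n} → Vec (Fin n) n → Maybe (Fin n) → (i : Fin (suc n)) → LastView i → Fin (suc n)
insertMaxAt τ nothing  _ last       = fromℕ _
insertMaxAt τ nothing  _ (inject j) = inject₁ (lookup τ j)
insertMaxAt τ (just k) _ last       = inject₁ (lookup τ k)
insertMaxAt τ (just k) _ (inject j) with j Fin.≟ k
... | yes _ = fromℕ _
... | no _  = inject₁ (lookup τ j)

insertMax : ∀ {n} → Vec (Fin n) n → Maybe (Fin n) → Vec (Fin (suc n)) (suc n)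
insertMax τ c = tabulate (λ i → insertMaxAt τ c i (lastView i))

module _ {n : ℕ} (τ : Vec (Fin n) n) where

  insertMax-nothing-last : lookup (insertMax τ nothing) (fromℕ n) ≡ fromℕ n
  insertMax-nothing-last rewrite lookup∘tabulate (λ i → insertMaxAt τ nothing i (lastView i)) (fromℕ n)
                               | lastView-fromℕ n = refl

  insertMax-nothing-inject₁ : ∀ j → lookup (insertMax τ nothing) (inject₁ j) ≡ inject₁ (lookup τ j)
  insertMax-nothing-inject₁ j rewrite lookup∘tabulate (λ i → insertMaxAt τ nothing i (lastView i)) (inject₁ j)
                                    | lastView-inject₁ j = refl

  insertMax-just-last : ∀ k → lookup (insertMax τ (just k)) (fromℕ n) ≡ inject₁ (lookup τ k)
  insertMax-just-last k rewrite lookup∘tabulate (λ i → insertMaxAt τ (just k) i (lastView i)) (fromℕ n)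
                              | lastView-fromℕ n = refl

  insertMax-just-inject₁ : ∀ k j → lookup (insertMax τ (just k)) (inject₁ j) ≡ insertMaxAt τ (just k) (inject₁ j) (inject j)
  insertMax-just-inject₁ k j rewrite lookup∘tabulate (λ i → insertMaxAt τ (just k) i (lastView i)) (inject₁ j)
                                   | lastView-inject₁ j = refl

  insertMax-just-at : ∀ k → lookup (insertMax τ (just k)) (inject₁ k) ≡ fromℕ n
  insertMax-just-at k rewrite insertMax-just-inject₁ k k with k Fin.≟ k
  ... | yes _   = refl
  ... | no k≢k = contradiction refl k≢k

  insertMax-just-other : ∀ k j → j ≢ k → lookup (insertMax τ (just k)) (inject₁ j) ≡ inject₁ (lookup τ j)
  insertMax-just-other k j j≢k rewrite insertMax-just-inject₁ k j with j Fin.≟ k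
  ... | yes j≡k = contradiction j≡k j≢k
  ... | no _    = refl

lookup-extensionality : ∀ {A : Set} {n} {xs ys : Vec A n} → (∀ i → lookup xs i ≡ lookup ys i) → xs ≡ ys
lookup-extensionality {xs = xs} {ys} eq = trans (sym (tabulate∘lookup xs)) (trans (tabulate-cong eq) (tabulate∘lookup ys))

lowerLast : ∀ {n} (x : Fin (suc n)) → x ≢ fromℕ n → Fin n
lowerLast x x≢last = Fin.lower₁ x (λ n≡x → x≢last (toℕ-injective (trans (sym n≡x) (sym (toℕ-fromℕ _)))))

inject₁-lowerLast : ∀ {n} (x : Fin (suc n)) (x≢last : x ≢ fromℕ n) → inject₁ (lowerLast x x≢last) ≡ x
inject₁-lowerLast x _ = inject₁-lower₁ x _

-- home c is the preimage of the new element n under insertMax τ c;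
-- position c j is the preimage of inject₁ (τ j).
home : ∀ {n} → Maybe (Fin n) → Fin (suc n)
home nothing  = fromℕ _
home (just k) = inject₁ k

position : ∀ {n} → Maybe (Fin n) → Fin n → Fin (suc n)
position nothing  j = inject₁ j
position (just k) j with j Fin.≟ k
... | yes _ = fromℕ _
... | no  _ = inject₁ j

home-injective : ∀ {n} {c c′ : Maybe (Fin n)} → home c ≡ home c′ → c ≡ c′
home-injective {c = nothing} {nothing} _ = refl
home-injective {c = nothing} {just k′} e = ⊥-elim (fromℕ≢inject₁ e)
home-injective {c = just k}  {nothing} e = ⊥-elim (fromℕ≢inject₁ (sym e))
home-injective {c = just k}  {just k′} e = cong just (inject₁-injective e)

position≢home : ∀ {n} (c : Maybe (Fin n)) j → position c j ≢ home c
position≢home nothing  j = fromℕ≢inject₁ ∘ sym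
position≢home (just k) j with j Fin.≟ k
... | yes _   = fromℕ≢inject₁
... | no j≢k = j≢k ∘ inject₁-injective

position-injective : ∀ {n} (c : Maybe (Fin n)) → Injective _≡_ _≡_ (position c)
position-injective nothing e = inject₁-injective e
position-injective (just k) {i} {j} e with i Fin.≟ k | j Fin.≟ k
... | yes i≡k | yes j≡k = trans i≡k (sym j≡k)
... | yes _   | no _    = ⊥-elim (fromℕ≢inject₁ e)
... | no _    | yes _   = ⊥-elim (fromℕ≢inject₁ (sym e))
... | no _    | no _    = inject₁-injective e

home-or-position : ∀ {n} (c : Maybe (Fin n)) i → i ≡ home c ⊎ ∃ λ j → i ≡ position c j
home-or-position c i with lastView i
home-or-position nothing  _ | last     = inj₁ refl
home-or-position nothing  _ | inject j = inj₂ (j , refl)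
home-or-position (just k) _ | last     = inj₂ (k , sym (at-k k))
  where
  at-k : ∀ {n} (k : Fin n) → position (just k) k ≡ fromℕ n
  at-k k with k Fin.≟ k
  ... | yes _   = refl
  ... | no k≢k = contradiction refl k≢k
home-or-position (just k) _ | inject j with j Fin.≟ k
... | yes j≡k = inj₁ (cong inject₁ j≡k)
... | no  j≢k = inj₂ (j , sym off-k)
  where
  off-k : position (just k) j ≡ inject₁ j
  off-k with j Fin.≟ k
  ... | yes j≡k′ = contradiction j≡k′ j≢k
  ... | no _     = refl

module _ {n : ℕ} (τ : Vec (Fin n) n) where

  insertMax-home : ∀ c → lookup (insertMax τ c) (home c) ≡ fromℕ n
  insertMax-home nothing  = insertMax-nothing-last τ
  insertMax-home (just k) = insertMax-just-at τ k

  insertMax-position : ∀ c j → lookup (insertMax τ c) (position c j) ≡ inject₁ (lookup τ j)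
  insertMax-position nothing  j = insertMax-nothing-inject₁ τ j
  insertMax-position (just k) j with j Fin.≟ k
  ... | yes refl = insertMax-just-last τ k
  ... | no j≢k  = insertMax-just-other τ k j j≢k

  insertMax-last⇒home : ∀ c {i} → lookup (insertMax τ c) i ≡ fromℕ n → i ≡ home c
  insertMax-last⇒home c {i} σi≡last with home-or-position c i
  ... | inj₁ i≡home       = i≡home
  ... | inj₂ (j , refl) = ⊥-elim (fromℕ≢inject₁ (trans (sym σi≡last) (insertMax-position c j)))

module _ {n : ℕ} {τ : Vec (Fin n) n} where

  lookup-insertMax-injective : Injective _≡_ _≡_ (lookup τ) → ∀ c → Injective _≡_ _≡_ (lookup (insertMax τ c))
  lookup-insertMax-injective τ-injective c {i} {i′} e with home-or-position c i | home-or-position c i′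
  ... | inj₁ refl       | inj₁ refl        = refl
  ... | inj₁ refl       | inj₂ (j′ , refl) =
    ⊥-elim (fromℕ≢inject₁ (trans (sym (insertMax-home τ c)) (trans e (insertMax-position τ c j′))))
  ... | inj₂ (j , refl) | inj₁ refl        =
    ⊥-elim (fromℕ≢inject₁ (trans (sym (insertMax-home τ c)) (trans (sym e) (insertMax-position τ c j))))
  ... | inj₂ (j , refl) | inj₂ (j′ , refl) =
    cong (position c) (τ-injective (inject₁-injective
      (trans (sym (insertMax-position τ c j)) (trans e (insertMax-position τ c j′)))))

  lookup-insertMax-injective⁻ : ∀ c → Injective _≡_ _≡_ (lookup (insertMax τ c)) → Injective _≡_ _≡_ (lookup τ)
  lookup-insertMax-injective⁻ c σ-injective {i} {j} e = position-injective c (σ-injective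
    (trans (insertMax-position τ c i) (trans (cong inject₁ e) (sym (insertMax-position τ c j)))))

insertMax-injective : ∀ {n} {τ τ′ : Vec (Fin n) n} {c c′} → insertMax τ c ≡ insertMax τ′ c′ → τ ≡ τ′ × c ≡ c′
insertMax-injective {n} {τ} {τ′} {c} {c′} e = lookup-extensionality τ≗τ′ , c≡c′
  where
  open ≡-Reasoning
  c≡c′ : c ≡ c′
  c≡c′ = home-injective (insertMax-last⇒home τ′ c′ (begin
    lookup (insertMax τ′ c′) (home c) ≡⟨ cong (λ σ → lookup σ (home c)) e ⟨
    lookup (insertMax τ c) (home c)   ≡⟨ insertMax-home τ c ⟩
    fromℕ n                           ∎))
  τ≗τ′ : ∀ j → lookup τ j ≡ lookup τ′ j
  τ≗τ′ j = inject₁-injective (begin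
    inject₁ (lookup τ j)                      ≡⟨ insertMax-position τ c j ⟨
    lookup (insertMax τ c) (position c j)     ≡⟨ cong (λ σ → lookup σ (position c j)) e ⟩
    lookup (insertMax τ′ c′) (position c j)   ≡⟨ cong (λ d → lookup (insertMax τ′ c′) (position d j)) c≡c′ ⟩
    lookup (insertMax τ′ c′) (position c′ j)  ≡⟨ insertMax-position τ′ c′ j ⟩
    inject₁ (lookup τ′ j)                     ∎)

insertMax-isPerm : ∀ {n} {τ : Vec (Fin n) n} c → T (isPerm τ) → T (isPerm (insertMax τ c))
insertMax-isPerm {τ = τ} c τ-perm =
  injective⇒distinct (insertMax τ c) (lookup-insertMax-injective (distinct⇒injective τ τ-perm) c)

codes : ∀ n → List (Maybe (Fin n))
codes n = nothing ∷ map just (allFin n)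

codes-unique : ∀ n → Unique (codes n)
codes-unique n = All.tabulate (λ {c} c∈ nothing≡c → just≢nothing c∈ (sym nothing≡c)) ∷ map⁺ just-injective (allFin⁺ n)
  where
  just≢nothing : ∀ {c} → c ∈ map just (allFin n) → c ≢ nothing
  just≢nothing c∈ refl with ∈-map⁻ just c∈
  ... | _ , _ , ()

∈-codes : ∀ {n} (c : Maybe (Fin n)) → c ∈ codes n
∈-codes nothing  = here refl
∈-codes (just k) = there (∈-map⁺ just (∈-allFin k))

unhome : ∀ {n} (i : Fin (suc n)) → ∃ λ c → home c ≡ i
unhome i with lastView i
... | last     = nothing , refl
... | inject j = just j , refl

insertMax-surjective : ∀ {n} {σ : Vec (Fin (suc n)) (suc n)} → T (isPerm σ) →
  ∃₂ λ τ c → T (isPerm τ) × c ∈ codes n × σ ≡ insertMax τ c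
insertMax-surjective {n} {σ} σ-perm =
  τ , code , injective⇒distinct τ (lookup-insertMax-injective⁻ code (subst (Injective _≡_ _≡_ ∘ lookup) σ≡ σ-injective)) ,
  ∈-codes code , σ≡
  where
  σ-injective = distinct⇒injective σ σ-perm
  h = proj₁ (injective⇒surjective σ-injective (fromℕ n))
  σh≡last = proj₂ (injective⇒surjective σ-injective (fromℕ n))
  code = proj₁ (unhome h)
  home≡h = proj₂ (unhome h)
  σ-home : lookup σ (home code) ≡ fromℕ n
  σ-home = trans (cong (lookup σ) home≡h) σh≡last
  σ-position≢last : ∀ j → lookup σ (position code j) ≢ fromℕ n
  σ-position≢last j e = position≢home code j (σ-injective (trans e (sym σ-home)))
  τ : Vec (Fin n) n
  τ = tabulate (λ j → lowerLast (lookup σ (position code j)) (σ-position≢last j))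
  σ-position : ∀ j → lookup σ (position code j) ≡ inject₁ (lookup τ j)
  σ-position j = sym (trans (cong inject₁ (lookup∘tabulate _ j)) (inject₁-lowerLast _ (σ-position≢last j)))
  σ≡ : σ ≡ insertMax τ code
  σ≡ = lookup-extensionality λ i → case home-or-position code i of λ where
    (inj₁ refl)       → trans σ-home (sym (insertMax-home τ code))
    (inj₂ (j , refl)) → trans (σ-position j) (sym (insertMax-position τ code j))

insertMax-parametrisation : ∀ n → Parametrisation n (Maybe (Fin n))
insertMax-parametrisation n = record
  { extend            = insertMax
  ; codes             = codes n
  ; codes-unique      = codes-unique n
  ; extend-injective  = insertMax-injective
  ; extend-isPerm     = insertMax-isPerm
  ; extend-surjective = insertMax-surjective
  }

T-extensionality : ∀ {a b : Bool} → (T a → T b) → (T b → T a) → a ≡ b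
T-extensionality {true}  {true}  _ _ = refl
T-extensionality {true}  {false} f _ = ⊥-elim (f _)
T-extensionality {false} {true}  _ g = ⊥-elim (g _)
T-extensionality {false} {false} _ _ = refl

module _ {n : ℕ} (σ : Vec (Fin n) n) where

  iter-+ : ∀ a d i → iter σ (a + d) i ≡ iter σ a (iter σ d i)
  iter-+ zero    d i = refl
  iter-+ (suc a) d i = cong (lookup σ) (iter-+ a d i)

  module _ (σ-injective : Injective _≡_ _≡_ (lookup σ)) where

    iter-injective : ∀ a → Injective _≡_ _≡_ (iter σ a)
    iter-injective zero    e = e
    iter-injective (suc a) e = iter-injective a (σ-injective e)

    -- Among the n+1 iterates σ⁰ i, …, σⁿ i two coincide, and injectivity cancels the smaller exponent.
    iter-period : ∀ i → ∃ λ p → 1 ≤ p × p ≤ n × iter σ p i ≡ i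
    iter-period i with pigeonhole ≤-refl (λ (a : Fin (suc n)) → iter σ (toℕ a) i)
    ... | a , b , a<b , σᵃi≡σᵇi with m≤n⇒∃[o]m+o≡n a<b
    ... | o , 1+a+o≡b = suc o , s≤s z≤n , 1+o≤n , sym (iter-injective (toℕ a) (begin
      iter σ (toℕ a) i                  ≡⟨ σᵃi≡σᵇi ⟩
      iter σ (toℕ b) i                  ≡⟨ cong (λ e → iter σ e i) b≡a+[1+o] ⟩
      iter σ (toℕ a + suc o) i          ≡⟨ iter-+ (toℕ a) (suc o) i ⟩
      iter σ (toℕ a) (iter σ (suc o) i) ∎))
      where
      open ≡-Reasoning
      b≡a+[1+o] : toℕ b ≡ toℕ a + suc o
      b≡a+[1+o] = trans (sym 1+a+o≡b) (sym (+-suc (toℕ a) o))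
      1+o≤n : suc o ≤ n
      1+o≤n = ≤-trans (m≤n+m (suc o) (toℕ a)) (≤-trans (≤-reflexive (sym b≡a+[1+o])) (toℕ≤pred[n] b))

    iter-within-period : ∀ i p → 1 ≤ p → iter σ p i ≡ i → ∀ m → ∃ λ r → 1 ≤ r × r ≤ p × iter σ m i ≡ iter σ r i
    iter-within-period i p 1≤p σᵖi≡i zero    = p , 1≤p , ≤-refl , sym σᵖi≡i
    iter-within-period i p 1≤p σᵖi≡i (suc m) with iter-within-period i p 1≤p σᵖi≡i m
    ... | r , 1≤r , r≤p , σᵐi≡σʳi with suc r ≤? p
    ...   | yes 1+r≤p = suc r , s≤s z≤n , 1+r≤p , cong (lookup σ) σᵐi≡σʳi
    ...   | no  1+r≰p = 1 , s≤s z≤n , 1≤p ,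
      cong (lookup σ) (trans σᵐi≡σʳi (trans (cong (λ e → iter σ e i) r≡p) σᵖi≡i))
      where r≡p = ≤-antisym r≤p (≮⇒≥ 1+r≰p)

    iter∈orbit : ∀ i m → iter σ m i ∈ orbit σ i
    iter∈orbit i m with iter-period i
    ... | p , 1≤p , p≤n , σᵖi≡i with iter-within-period i p 1≤p σᵖi≡i m
    ... | suc r , _ , 1+r≤p , σᵐi≡σʳi = subst (_∈ orbit σ i) (sym σᵐi≡σʳi)
      (subst (λ e → iter σ (suc e) i ∈ orbit σ i) (toℕ-fromℕ< r<n)
        (∈-map⁺ (λ k → iter σ (suc (toℕ k)) i) (∈-allFin (Fin.fromℕ< r<n))))
      where r<n = ≤-trans 1+r≤p p≤n

    isCycleMin⇒≤iter : ∀ {i} → T (isCycleMin σ i) → ∀ m → toℕ i ≤ toℕ (iter σ m i)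
    isCycleMin⇒≤iter {i} i-min m =
      ≤ᵇ⇒≤ _ _ (All.lookup (all⁺ (λ j → toℕ i ≤ᵇ toℕ j) (orbit σ i) i-min) (iter∈orbit i m))

  ≤iter⇒isCycleMin : ∀ {i} → (∀ m → toℕ i ≤ toℕ (iter σ m i)) → T (isCycleMin σ i)
  ≤iter⇒isCycleMin {i} i≤ = all⁻ (λ j → toℕ i ≤ᵇ toℕ j) {orbit σ i}
    (All.tabulate λ x∈ → case ∈-map⁻ _ x∈ of λ where
    (k , _ , refl) → ≤⇒≤ᵇ (i≤ (suc (toℕ k))))

module _ {n : ℕ} (τ : Vec (Fin n) n) where

  insertMax-step : ∀ c y → lookup (insertMax τ c) (inject₁ y) ≡ inject₁ (lookup τ y)
                         ⊎ (c ≡ just y × lookup (insertMax τ c) (inject₁ y) ≡ fromℕ n)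
  insertMax-step nothing  y = inj₁ (insertMax-nothing-inject₁ τ y)
  insertMax-step (just k) y with y Fin.≟ k
  ... | yes refl = inj₂ (refl , insertMax-just-at τ k)
  ... | no y≢k  = inj₁ (insertMax-just-other τ k y y≢k)

  insertMax-leave-last : ∀ c y → c ≡ just y → lookup (insertMax τ c) (fromℕ n) ≡ inject₁ (lookup τ y)
  insertMax-leave-last _ y refl = insertMax-just-last τ y

  -- The σ-orbit of inject₁ j is the τ-orbit of j, with n inserted after k when c = just k.
  iter-insertMax⁻ : ∀ c j m → ∃ λ m′ → iter (insertMax τ c) m (inject₁ j) ≡ inject₁ (iter τ m′ j)
                                   ⊎ (iter (insertMax τ c) m (inject₁ j) ≡ fromℕ n × c ≡ just (iter τ m′ j))
  iter-insertMax⁻ c j zero = 0 , inj₁ refl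
  iter-insertMax⁻ c j (suc m) with iter-insertMax⁻ c j m
  ... | m′ , inj₂ (σᵐ≡last , c≡) =
    suc m′ , inj₁ (trans (cong (lookup (insertMax τ c)) σᵐ≡last) (insertMax-leave-last c _ c≡))
  ... | m′ , inj₁ σᵐ≡τᵐ′ with insertMax-step c (iter τ m′ j)
  ...   | inj₁ step         = suc m′ , inj₁ (trans (cong (lookup (insertMax τ c)) σᵐ≡τᵐ′) step)
  ...   | inj₂ (c≡ , step) = m′ , inj₂ (trans (cong (lookup (insertMax τ c)) σᵐ≡τᵐ′) step , c≡)

  iter-insertMax⁺ : ∀ c j m′ → ∃ λ m → iter (insertMax τ c) m (inject₁ j) ≡ inject₁ (iter τ m′ j)
  iter-insertMax⁺ c j zero = 0 , refl
  iter-insertMax⁺ c j (suc m′) with iter-insertMax⁺ c j m′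
  ... | m , σᵐ≡τᵐ′ with insertMax-step c (iter τ m′ j)
  ...   | inj₁ step         = suc m , trans (cong (lookup (insertMax τ c)) σᵐ≡τᵐ′) step
  ...   | inj₂ (c≡ , step) = suc (suc m) , trans (cong (lookup (insertMax τ c))
                               (trans (cong (lookup (insertMax τ c)) σᵐ≡τᵐ′) step)) (insertMax-leave-last c _ c≡)

  iter-insertMax-nothing-last : ∀ m → iter (insertMax τ nothing) m (fromℕ n) ≡ fromℕ n
  iter-insertMax-nothing-last zero    = refl
  iter-insertMax-nothing-last (suc m) =
    trans (cong (lookup (insertMax τ nothing)) (iter-insertMax-nothing-last m)) (insertMax-nothing-last τ)

  module _ (τ-injective : Injective _≡_ _≡_ (lookup τ)) (c : Maybe (Fin n)) where

    private
      σ-injective = lookup-insertMax-injective {τ = τ} τ-injective c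

    isCycleMin-insertMax-inject₁ : ∀ j → isCycleMin (insertMax τ c) (inject₁ j) ≡ isCycleMin τ j
    isCycleMin-insertMax-inject₁ j = T-extensionality
      (λ σ-min → ≤iter⇒isCycleMin τ λ m′ → let m , σᵐ≡τᵐ′ = iter-insertMax⁺ c j m′ in
        subst₂ _≤_ (toℕ-inject₁ j) (trans (cong toℕ σᵐ≡τᵐ′) (toℕ-inject₁ _))
          (isCycleMin⇒≤iter (insertMax τ c) σ-injective σ-min m))
      (λ τ-min → ≤iter⇒isCycleMin (insertMax τ c) λ m → case iter-insertMax⁻ c j m of λ where
        (m′ , inj₁ σᵐ≡τᵐ′) → subst₂ _≤_ (sym (toℕ-inject₁ j)) (sym (trans (cong toℕ σᵐ≡τᵐ′) (toℕ-inject₁ _)))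
                                (isCycleMin⇒≤iter τ τ-injective τ-min m′)
        (_ , inj₂ (σᵐ≡last , _)) → subst (toℕ (inject₁ j) ≤_) (cong toℕ (sym σᵐ≡last)) (≤fromℕ (inject₁ j)))

    isCycleMin-insertMax-last : isCycleMin (insertMax τ c) (fromℕ n) ≡ is-nothing c
    isCycleMin-insertMax-last = last-min c
      where
      last-min : ∀ c → isCycleMin (insertMax τ c) (fromℕ n) ≡ is-nothing c
      last-min nothing  = T-extensionality _ λ _ →
        ≤iter⇒isCycleMin (insertMax τ nothing) (≤-reflexive ∘ cong toℕ ∘ sym ∘ iter-insertMax-nothing-last)
      last-min (just k) = T-extensionality (λ last-min → <⇒≱ σlast<last
        (isCycleMin⇒≤iter (insertMax τ (just k)) (lookup-insertMax-injective {τ = τ} τ-injective (just k)) last-min 1)) λ ()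
        where
        σlast<last : toℕ (lookup (insertMax τ (just k)) (fromℕ n)) < toℕ (fromℕ n)
        σlast<last = subst₂ _<_ (sym (trans (cong toℕ (insertMax-just-last τ k)) (toℕ-inject₁ _))) (sym (toℕ-fromℕ n))
                       (toℕ<n (lookup τ k))

    numCycles-insertMax : numCycles (insertMax τ c) ≡ numCycles τ + ind (is-nothing c)
    numCycles-insertMax = trans (countB-allFin-last (isCycleMin (insertMax τ c)))
      (cong₂ _+_ (countB-cong isCycleMin-insertMax-inject₁ (allFin n)) (cong ind isCycleMin-insertMax-last))

cycles-recurrence : ∀ n j → c (suc n) j ≡ countB (λ τ → suc (numCycles τ) ≡ᵇ j) (Sym n) + n * c n j
cycles-recurrence n j = begin
  c (suc n) j
    ≡⟨ countB-Sym-suc (insertMax-parametrisation n) (λ σ → numCycles σ ≡ᵇ j) ⟩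
  ∑ (λ τ → countB (λ d → numCycles (insertMax τ d) ≡ᵇ j) (codes n)) (Sym n)
    ≡⟨ ∑-cong∈ (Sym n) (λ {τ} τ∈ → count-codes τ (distinct⇒injective τ (∈-Sym⁻ τ∈))) ⟩
  ∑ (λ τ → 1 * ind (suc (numCycles τ) ≡ᵇ j) + n * ind (numCycles τ ≡ᵇ j)) (Sym n)
    ≡⟨ ∑-linear 1 n _ _ (Sym n) ⟩
  1 * countB (λ τ → suc (numCycles τ) ≡ᵇ j) (Sym n) + n * c n j
    ≡⟨ cong (_+ n * c n j) (*-identityˡ _) ⟩
  countB (λ τ → suc (numCycles τ) ≡ᵇ j) (Sym n) + n * c n j
    ∎
  where
  open ≡-Reasoning
  count-codes : ∀ τ → Injective _≡_ _≡_ (lookup τ) →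
    countB (λ d → numCycles (insertMax τ d) ≡ᵇ j) (codes n) ≡ 1 * ind (suc (numCycles τ) ≡ᵇ j) + n * ind (numCycles τ ≡ᵇ j)
  count-codes τ τ-injective = begin
    countB (λ d → numCycles (insertMax τ d) ≡ᵇ j) (codes n)
      ≡⟨ countB-∷ _ nothing (map just (allFin n)) ⟩
    ind (numCycles (insertMax τ nothing) ≡ᵇ j) + countB (λ d → numCycles (insertMax τ d) ≡ᵇ j) (map just (allFin n))
      ≡⟨ cong₂ _+_ (cong (λ m → ind (m ≡ᵇ j)) (trans (numCycles-insertMax τ τ-injective nothing) (+-comm _ 1)))
                   (countB-map _ just (allFin n)) ⟩
    ind (suc (numCycles τ) ≡ᵇ j) + countB (λ k → numCycles (insertMax τ (just k)) ≡ᵇ j) (allFin n)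
      ≡⟨ cong₂ _+_ (sym (*-identityˡ _)) (countB-allFin-const _ _ λ k →
           cong (_≡ᵇ j) (trans (numCycles-insertMax τ τ-injective (just k)) (+-identityʳ _))) ⟩
    1 * ind (suc (numCycles τ) ≡ᵇ j) + n * ind (numCycles τ ≡ᵇ j)
      ∎

c-suc-0 : ∀ m → c (suc m) 0 ≡ 0
c-suc-0 zero    = refl
c-suc-0 (suc m) = begin
  c (suc (suc m)) 0
    ≡⟨ cycles-recurrence (suc m) 0 ⟩
  countB (λ τ → suc (numCycles τ) ≡ᵇ 0) (Sym (suc m)) + suc m * c (suc m) 0
    ≡⟨ cong₂ _+_ (trans (countB-const _ false (λ _ → refl) (Sym (suc m))) (*-zeroʳ (length (Sym (suc m)))))
                 (cong (suc m *_) (c-suc-0 m)) ⟩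
  0 + suc m * 0
    ≡⟨ *-zeroʳ (suc m) ⟩
  0 ∎
  where open ≡-Reasoning

c-suc-1 : ∀ m → c (suc (suc m)) 1 ≡ suc m * c (suc m) 1
c-suc-1 m = trans (cycles-recurrence (suc m) 1) (cong (_+ suc m * c (suc m) 1) (c-suc-0 m))

c-suc-suc : ∀ n j → c (suc n) (suc j) ≡ c n j + n * c n (suc j)
c-suc-suc n j = cycles-recurrence n (suc j)

matchesRight : ℕ → List ℕ → Bool
matchesRight = matchesAt []

-- mmp of a suffix, when the entries already read have maximum m.
mmpFrom : ℕ → List ℕ → ℕ
mmpFrom m []         = 0
mmpFrom m (x ∷ post) = ind ((m ≤ᵇ x) ∧ matchesRight x post) + mmpFrom (m ⊔ x) post

all-≤ᵇ : ∀ x pre → all (_≤ᵇ x) pre ≡ (maxList pre ≤ᵇ x)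
all-≤ᵇ x []        = refl
all-≤ᵇ x (y ∷ pre) = trans (cong ((y ≤ᵇ x) ∧_) (all-≤ᵇ x pre)) (T-extensionality
  (λ h → let y≤x , m≤x = Equivalence.to T-∧ h in ≤⇒≤ᵇ (⊔-lub (≤ᵇ⇒≤ y x y≤x) (≤ᵇ⇒≤ _ x m≤x)))
  (λ h → let y⊔m≤x = ≤ᵇ⇒≤ _ x h in Equivalence.from T-∧ (≤⇒≤ᵇ (m⊔n≤o⇒m≤o y _ y⊔m≤x) , ≤⇒≤ᵇ (m⊔n≤o⇒n≤o y _ y⊔m≤x))))

matchesAt-split : ∀ pre x post → matchesAt pre x post ≡ (maxList pre ≤ᵇ x) ∧ matchesRight x post
matchesAt-split pre x []       = sym (∧-zeroʳ _)
matchesAt-split pre x (_ ∷ _) = cong (_∧ _) (all-≤ᵇ x pre)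

maxList-++-[x] : ∀ pre x → maxList (pre ++ [ x ]) ≡ maxList pre ⊔ x
maxList-++-[x] []        x = ⊔-identityʳ x
maxList-++-[x] (y ∷ pre) x = trans (cong (y ⊔_) (maxList-++-[x] pre x)) (sym (⊔-assoc y _ x))

mmpAux≡mmpFrom : ∀ pre post → mmpAux pre post ≡ mmpFrom (maxList pre) post
mmpAux≡mmpFrom pre []         = refl
mmpAux≡mmpFrom pre (x ∷ post) = cong₂ _+_ (cong ind (matchesAt-split pre x post))
  (trans (mmpAux≡mmpFrom (pre ++ [ x ]) post) (cong (λ m → mmpFrom m post) (maxList-++-[x] pre x)))

mmp≡mmpFrom0 : ∀ l → mmp l ≡ mmpFrom 0 l
mmp≡mmpFrom0 = mmpAux≡mmpFrom []

aboveUpToMax : ℕ → List ℕ → ℕ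
aboveUpToMax x l = countB (x <ᵇ_) (takeThrough (maxList l) l)

-- Position of the first occurrence of the maximum, counted from 1.
lengthToMax : List ℕ → ℕ
lengthToMax l = length (takeThrough (maxList l) l)

maxList-map-suc : ∀ y ys → maxList (map suc (y ∷ ys)) ≡ suc (maxList (y ∷ ys))
maxList-map-suc y []       = cong suc (sym (⊔-identityʳ y))
maxList-map-suc y (z ∷ zs) = cong (suc y ⊔_) (maxList-map-suc z zs)

takeThrough-map-suc : ∀ m l → takeThrough (suc m) (map suc l) ≡ map suc (takeThrough m l)
takeThrough-map-suc m []      = refl
takeThrough-map-suc m (y ∷ l) with y ≡ᵇ m
... | true  = refl
... | false = cong (suc y ∷_) (takeThrough-map-suc m l)

takeThrough-maxList-map-suc : ∀ y ys → takeThrough (maxList (map suc (y ∷ ys))) (map suc (y ∷ ys)) ≡ map suc (takeThrough (maxList (y ∷ ys)) (y ∷ ys))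
takeThrough-maxList-map-suc y ys = trans (cong (λ m → takeThrough m (map suc (y ∷ ys))) (maxList-map-suc y ys))
  (takeThrough-map-suc (maxList (y ∷ ys)) (y ∷ ys))

aboveUpToMax-map-suc : ∀ x y ys → aboveUpToMax (suc x) (map suc (y ∷ ys)) ≡ aboveUpToMax x (y ∷ ys)
aboveUpToMax-map-suc x y ys = trans (cong (countB (suc x <ᵇ_)) (takeThrough-maxList-map-suc y ys))
  (countB-map (suc x <ᵇ_) suc (takeThrough (maxList (y ∷ ys)) (y ∷ ys)))

matchesRight-map-suc : ∀ x l → matchesRight (suc x) (map suc l) ≡ matchesRight x l
matchesRight-map-suc x []       = refl
matchesRight-map-suc x (y ∷ ys) = cong (3 ≤ᵇ_) (aboveUpToMax-map-suc x y ys)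

suc≤ᵇsuc : ∀ m x → (suc m ≤ᵇ suc x) ≡ (m ≤ᵇ x)
suc≤ᵇsuc zero    x = refl
suc≤ᵇsuc (suc m) x = refl

mmpFrom-map-suc : ∀ m l → mmpFrom (suc m) (map suc l) ≡ mmpFrom m l
mmpFrom-map-suc m []      = refl
mmpFrom-map-suc m (x ∷ l) =
  cong₂ _+_ (cong₂ (λ a b → ind (a ∧ b)) (suc≤ᵇsuc m x) (matchesRight-map-suc x l)) (mmpFrom-map-suc (m ⊔ x) l)

mmpFrom0-map-suc : ∀ l → mmpFrom 0 (map suc l) ≡ mmpFrom 0 l
mmpFrom0-map-suc []      = refl
mmpFrom0-map-suc (x ∷ l) = cong₂ _+_ (cong ind (matchesRight-map-suc x l)) (mmpFrom-map-suc x l)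

-- The list analogue of insertMin: the new least entry 0 is placed at position k.
insertZeroAt : ℕ → List ℕ → List ℕ
insertZeroAt zero    l       = 0 ∷ map suc l
insertZeroAt (suc k) []      = 0 ∷ []
insertZeroAt (suc k) (x ∷ l) = suc x ∷ insertZeroAt k l

entries-map-fsuc : ∀ {n m} (τ : Vec (Fin n) m) → entries (Vec.map fsuc τ) ≡ map suc (entries τ)
entries-map-fsuc Vec.[]      = refl
entries-map-fsuc (x Vec.∷ τ) = cong (suc (toℕ x) ∷_) (entries-map-fsuc τ)

entries-insertMin : ∀ {n m} (τ : Vec (Fin n) m) k → entries (insertAt (Vec.map fsuc τ) k fzero) ≡ insertZeroAt (toℕ k) (entries τ)
entries-insertMin τ           fzero    = cong (0 ∷_) (entries-map-fsuc τ)
entries-insertMin (x Vec.∷ τ) (fsuc k) = cong (suc (toℕ x) ∷_) (entries-insertMin τ k)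

maxList-insertZeroAt : ∀ k l → maxList (insertZeroAt k l) ≡ maxList (map suc l)
maxList-insertZeroAt zero    l       = refl
maxList-insertZeroAt (suc k) []      = refl
maxList-insertZeroAt (suc k) (x ∷ l) = cong (suc x ⊔_) (maxList-insertZeroAt k l)

countB-takeThrough-insertZeroAt : ∀ (q : ℕ → Bool) → q 0 ≡ false → ∀ m k l →
  countB q (takeThrough (suc m) (insertZeroAt k l)) ≡ countB q (takeThrough (suc m) (map suc l))
countB-takeThrough-insertZeroAt q q0 m zero    l       = trans (countB-∷ q 0 _) (cong (λ b → ind b + countB q (takeThrough (suc m) (map suc l))) q0)
countB-takeThrough-insertZeroAt q q0 m (suc k) []      = trans (countB-∷ q 0 []) (cong (λ b → ind b + 0) q0)
countB-takeThrough-insertZeroAt q q0 m (suc k) (x ∷ l) with x ≡ᵇ m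
... | true  = refl
... | false = trans (countB-∷ q (suc x) _)
  (trans (cong (ind (q (suc x)) +_) (countB-takeThrough-insertZeroAt q q0 m k l)) (sym (countB-∷ q (suc x) _)))

aboveUpToMax-insertZeroAt : ∀ x k y ys → aboveUpToMax (suc x) (insertZeroAt k (y ∷ ys)) ≡ aboveUpToMax x (y ∷ ys)
aboveUpToMax-insertZeroAt x k y ys = begin
  countB (suc x <ᵇ_) (takeThrough (maxList (insertZeroAt k l)) (insertZeroAt k l))
    ≡⟨ cong (λ m → countB (suc x <ᵇ_) (takeThrough m (insertZeroAt k l))) (trans (maxList-insertZeroAt k l) (maxList-map-suc y ys)) ⟩
  countB (suc x <ᵇ_) (takeThrough (suc (maxList l)) (insertZeroAt k l))
    ≡⟨ countB-takeThrough-insertZeroAt (suc x <ᵇ_) refl (maxList l) k l ⟩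
  countB (suc x <ᵇ_) (takeThrough (suc (maxList l)) (map suc l))
    ≡⟨ cong (λ m → countB (suc x <ᵇ_) (takeThrough m (map suc l))) (maxList-map-suc y ys) ⟨
  aboveUpToMax (suc x) (map suc l)
    ≡⟨ aboveUpToMax-map-suc x y ys ⟩
  aboveUpToMax x l
    ∎
  where
  open ≡-Reasoning
  l = y ∷ ys

matchesRight-insertZeroAt : ∀ x k l → matchesRight (suc x) (insertZeroAt k l) ≡ matchesRight x l
matchesRight-insertZeroAt x zero    []       = refl
matchesRight-insertZeroAt x (suc k) []       = refl
matchesRight-insertZeroAt x zero    (y ∷ ys) = cong (3 ≤ᵇ_) (aboveUpToMax-insertZeroAt x zero y ys)
matchesRight-insertZeroAt x (suc k) (y ∷ ys) = cong (3 ≤ᵇ_) (aboveUpToMax-insertZeroAt x (suc k) y ys)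

mmpFrom-insertZeroAt : ∀ m k l → mmpFrom (suc m) (insertZeroAt k l) ≡ mmpFrom m l
mmpFrom-insertZeroAt m zero    l       = mmpFrom-map-suc m l
mmpFrom-insertZeroAt m (suc k) []      = refl
mmpFrom-insertZeroAt m (suc k) (x ∷ l) =
  cong₂ _+_ (cong₂ (λ a b → ind (a ∧ b)) (suc≤ᵇsuc m x) (matchesRight-insertZeroAt x k l)) (mmpFrom-insertZeroAt (m ⊔ x) k l)

-- A 0 placed after the first entry is never a left-to-right maximum and never exceeds anything.
mmp-insertZeroAt-suc : ∀ k l → mmp (insertZeroAt (suc k) l) ≡ mmp l
mmp-insertZeroAt-suc k []      = refl
mmp-insertZeroAt-suc k (x ∷ l) = begin
  mmp (suc x ∷ insertZeroAt k l)
    ≡⟨ mmp≡mmpFrom0 (suc x ∷ insertZeroAt k l) ⟩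
  ind (matchesRight (suc x) (insertZeroAt k l)) + mmpFrom (suc x) (insertZeroAt k l)
    ≡⟨ cong₂ _+_ (cong ind (matchesRight-insertZeroAt x k l)) (mmpFrom-insertZeroAt x k l) ⟩
  ind (matchesRight x l) + mmpFrom x l
    ≡⟨ mmp≡mmpFrom0 (x ∷ l) ⟨
  mmp (x ∷ l)
    ∎
  where open ≡-Reasoning

countB-true : ∀ (l : List ℕ) → countB (λ _ → true) l ≡ length l
countB-true []      = refl
countB-true (x ∷ l) = cong suc (countB-true l)

-- A new first entry 0 is a left-to-right maximum, and every entry up to the maximum exceeds it.
mmp-insertZeroAt-zero : ∀ y ys → mmp (insertZeroAt 0 (y ∷ ys)) ≡ ind (3 ≤ᵇ lengthToMax (y ∷ ys)) + mmp (y ∷ ys)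
mmp-insertZeroAt-zero y ys = begin
  mmp (0 ∷ map suc l)
    ≡⟨ mmp≡mmpFrom0 (0 ∷ map suc l) ⟩
  ind (3 ≤ᵇ aboveUpToMax 0 (map suc l)) + mmpFrom 0 (map suc l)
    ≡⟨ cong₂ (λ t r → ind (3 ≤ᵇ t) + r) above0 (trans (mmpFrom0-map-suc l) (sym (mmp≡mmpFrom0 l))) ⟩
  ind (3 ≤ᵇ lengthToMax l) + mmp l
    ∎
  where
  open ≡-Reasoning
  l = y ∷ ys
  above0 : aboveUpToMax 0 (map suc l) ≡ lengthToMax l
  above0 = trans (cong (countB (0 <ᵇ_)) (takeThrough-maxList-map-suc y ys))
    (trans (countB-map (0 <ᵇ_) suc (takeThrough (maxList l) l)) (countB-true (takeThrough (maxList l) l)))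

≤-maxList : ∀ l → All (_≤ maxList l) l
≤-maxList []      = []
≤-maxList (y ∷ l) = m≤m⊔n y (maxList l) ∷ All.map (λ z≤ → ≤-trans z≤ (m≤n⊔m y (maxList l))) (≤-maxList l)

maxList-≤ : ∀ {x} l → All (_≤ x) l → maxList l ≤ x
maxList-≤ []      []            = z≤n
maxList-≤ (y ∷ l) (y≤x ∷ l≤x) = ⊔-lub y≤x (maxList-≤ l l≤x)

All-takeThrough : ∀ {P : ℕ → Set} m l → All P l → All P (takeThrough m l)
All-takeThrough m []      []         = []
All-takeThrough m (y ∷ l) (py ∷ pl) with y ≡ᵇ m
... | true  = py ∷ []
... | false = py ∷ All-takeThrough m l pl

countB-<ᵇ-bounded : ∀ x l → All (_≤ x) l → countB (x <ᵇ_) l ≡ 0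
countB-<ᵇ-bounded x []      []            = refl
countB-<ᵇ-bounded x (y ∷ l) (y≤x ∷ l≤x) with x <ᵇ y | <ᵇ⇒< x y
... | false | _     = countB-<ᵇ-bounded x l l≤x
... | true  | x<y = contradiction y≤x (<⇒≱ (x<y _))

matchesRight-bounded : ∀ x post → All (_≤ x) post → matchesRight x post ≡ false
matchesRight-bounded x []       _    = refl
matchesRight-bounded x (y ∷ ys) post≤x =
  cong (3 ≤ᵇ_) (countB-<ᵇ-bounded x _ (All-takeThrough (maxList (y ∷ ys)) (y ∷ ys) post≤x))

mmpFrom-bounded : ∀ m l → All (_≤ m) l → mmpFrom m l ≡ 0
mmpFrom-bounded m []      []            = refl
mmpFrom-bounded m (x ∷ l) (x≤m ∷ l≤m) = cong₂ _+_ head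
  (mmpFrom-bounded (m ⊔ x) l (All.map (λ z≤m → ≤-trans z≤m (m≤m⊔n m x)) l≤m))
  where
  head : ind ((m ≤ᵇ x) ∧ matchesRight x l) ≡ 0
  head with m ≤ᵇ x | ≤ᵇ⇒≤ m x
  ... | false | _     = refl
  ... | true  | m≤x = cong ind (matchesRight-bounded x l (All.map (λ z≤m → ≤-trans z≤m (m≤x _)) l≤m))

mmp-max-first : ∀ x l → All (_≤ x) l → mmp (x ∷ l) ≡ 0
mmp-max-first x l l≤x = trans (mmp≡mmpFrom0 (x ∷ l))
  (cong₂ _+_ (cong ind (matchesRight-bounded x l l≤x)) (mmpFrom-bounded x l l≤x))

-- Only the maximum itself lies between position 1 and the maximum, so fewer than 3 entries exceed x.
mmp-max-second : ∀ x y l → x ≤ y → All (_≤ y) l → mmp (x ∷ y ∷ l) ≡ 0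
mmp-max-second x y l x≤y l≤y = begin
  mmp (x ∷ y ∷ l)
    ≡⟨ mmp≡mmpFrom0 (x ∷ y ∷ l) ⟩
  ind (matchesRight x (y ∷ l)) + (ind ((x ≤ᵇ y) ∧ matchesRight y l) + mmpFrom (x ⊔ y) l)
    ≡⟨ cong₂ _+_ (cong ind first) (cong₂ _+_ (cong (λ b → ind ((x ≤ᵇ y) ∧ b)) (matchesRight-bounded y l l≤y)) rest) ⟩
  0 + (ind ((x ≤ᵇ y) ∧ false) + 0)
    ≡⟨ cong (λ b → ind b + 0) (∧-zeroʳ (x ≤ᵇ y)) ⟩
  0 ∎
  where
  open ≡-Reasoning
  rest : mmpFrom (x ⊔ y) l ≡ 0
  rest = mmpFrom-bounded (x ⊔ y) l (All.map (λ z≤y → ≤-trans z≤y (m≤n⊔m x y)) l≤y)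
  y-is-max : maxList (y ∷ l) ≡ y
  y-is-max = m≥n⇒m⊔n≡m (maxList-≤ l l≤y)
  first : matchesRight x (y ∷ l) ≡ false
  first rewrite y-is-max | Equivalence.to T-≡ (≡⇒≡ᵇ y y refl) with x <ᵇ y
  ... | true  = refl
  ... | false = refl

lengthToMax≤2⇒mmp≡0 : ∀ l → lengthToMax l ≤ 2 → mmp l ≡ 0
lengthToMax≤2⇒mmp≡0 []           _ = refl
lengthToMax≤2⇒mmp≡0 (x ∷ [])     _ = mmp-max-first x [] []
lengthToMax≤2⇒mmp≡0 (x ∷ y ∷ []) _ with ≤-total x y
... | inj₁ x≤y = mmp-max-second x y [] x≤y []
... | inj₂ y≤x = mmp-max-first x (y ∷ []) (y≤x ∷ [])
lengthToMax≤2⇒mmp≡0 (x ∷ y ∷ z ∷ l) T≤2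
  with x ≡ᵇ max | ≡ᵇ⇒≡ x max | y ≡ᵇ max | ≡ᵇ⇒≡ y max | ≤-maxList (x ∷ y ∷ z ∷ l)
  where max = maxList (x ∷ y ∷ z ∷ l)
... | true  | x≡max | _     | _     | _ ∷ l≤max =
  mmp-max-first x (y ∷ z ∷ l) (subst (λ m → All (_≤ m) (y ∷ z ∷ l)) (sym (x≡max _)) l≤max)
... | false | _     | true  | y≡max | x≤max ∷ _ ∷ l≤max =
  mmp-max-second x y (z ∷ l) (subst (x ≤_) (sym (y≡max _)) x≤max) (subst (λ m → All (_≤ m) (z ∷ l)) (sym (y≡max _)) l≤max)
... | false | _     | false | _     | _ with T≤2
...   | s≤s (s≤s ())

-- The new length of a prefix of length t after an entry is inserted at position k.
lengthAfterInsert : ℕ → ℕ → ℕ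
lengthAfterInsert k t = if k <ᵇ t then suc t else t

maxList-∈ : ∀ y ys → maxList (y ∷ ys) ∈ y ∷ ys
maxList-∈ y []       = here (⊔-identityʳ y)
maxList-∈ y (z ∷ zs) with ⊔-sel y (maxList (z ∷ zs))
... | inj₁ y⊔m≡y = here y⊔m≡y
... | inj₂ y⊔m≡m = there (subst (_∈ z ∷ zs) (sym y⊔m≡m) (maxList-∈ z zs))

length-takeThrough-insertZeroAt : ∀ m k l → m ∈ l →
  length (takeThrough (suc m) (insertZeroAt k l)) ≡ lengthAfterInsert k (length (takeThrough m l))
length-takeThrough-insertZeroAt m zero    (x ∷ l) _ =
  cong suc (trans (cong length (takeThrough-map-suc m (x ∷ l))) (length-map suc (takeThrough m (x ∷ l))))
length-takeThrough-insertZeroAt m (suc k) (x ∷ l) m∈ with x ≡ᵇ m | ≡⇒≡ᵇ x m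
... | true  | _    = refl
... | false | x≢m with m∈
...   | here m≡x   = ⊥-elim (x≢m (sym m≡x))
...   | there m∈l rewrite length-takeThrough-insertZeroAt m k l m∈l with k <ᵇ length (takeThrough m l)
...     | true  = refl
...     | false = refl

lengthToMax-insertZeroAt : ∀ k y ys → lengthToMax (insertZeroAt k (y ∷ ys)) ≡ lengthAfterInsert k (lengthToMax (y ∷ ys))
lengthToMax-insertZeroAt k y ys = trans
  (cong (λ m → length (takeThrough m (insertZeroAt k (y ∷ ys)))) (trans (maxList-insertZeroAt k (y ∷ ys)) (maxList-map-suc y ys)))
  (length-takeThrough-insertZeroAt (maxList (y ∷ ys)) k (y ∷ ys) (maxList-∈ y ys))

lengthAfterInsert-suc≡1 : ∀ k t → 1 ≤ t → (lengthAfterInsert (suc k) t ≡ᵇ 1) ≡ (t ≡ᵇ 1)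
lengthAfterInsert-suc≡1 k 1             _ = refl
lengthAfterInsert-suc≡1 k (suc (suc t)) _ with k <ᵇ suc t
... | true  = refl
... | false = refl

lengthAfterInsert-0≤2 : ∀ t → 1 ≤ t → (lengthAfterInsert 0 t ≤ᵇ 2) ≡ (t ≡ᵇ 1)
lengthAfterInsert-0≤2 1             _ = refl
lengthAfterInsert-0≤2 (suc (suc t)) _ = refl

lengthAfterInsert-1≤2 : ∀ t → 1 ≤ t → (lengthAfterInsert 1 t ≤ᵇ 2) ≡ (t ≡ᵇ 1)
lengthAfterInsert-1≤2 1             _ = refl
lengthAfterInsert-1≤2 (suc (suc t)) _ = refl

lengthAfterInsert-2+≤2 : ∀ k t → 1 ≤ t → (lengthAfterInsert (suc (suc k)) t ≤ᵇ 2) ≡ (t ≤ᵇ 2)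
lengthAfterInsert-2+≤2 k 1                   _ = refl
lengthAfterInsert-2+≤2 k 2                   _ = refl
lengthAfterInsert-2+≤2 k (suc (suc (suc t))) _ with k <ᵇ suc t
... | true  = refl
... | false = refl

maxPosition : ∀ {n} → Vec (Fin n) n → ℕ
maxPosition σ = lengthToMax (entries σ)

maxFirst : ℕ → ℕ
maxFirst n = countB (λ σ → maxPosition σ ≡ᵇ 1) (Sym n)

maxInFirstTwo : ℕ → ℕ
maxInFirstTwo n = countB (λ σ → maxPosition σ ≤ᵇ 2) (Sym n)

count-by-insertMin : ∀ {n} (p : Vec (Fin (suc n)) (suc n) → Bool) a b (q r : Vec (Fin n) n → Bool) →
  (∀ τ → countB (p ∘ insertMin τ) (allFin (suc n)) ≡ a * ind (q τ) + b * ind (r τ)) →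
  countB p (Sym (suc n)) ≡ a * countB q (Sym n) + b * countB r (Sym n)
count-by-insertMin {n} p a b q r pointwise = trans (countB-Sym-suc (insertMin-parametrisation n) p)
  (trans (∑-cong∈ (Sym n) (λ {τ} _ → pointwise τ)) (∑-linear a b q r (Sym n)))

module _ {m : ℕ} (x : Fin (suc m)) (τ : Vec (Fin (suc m)) m) where

  maxPosition-insertMin : ∀ k → maxPosition (insertMin (x Vec.∷ τ) k) ≡ lengthAfterInsert (toℕ k) (maxPosition (x Vec.∷ τ))
  maxPosition-insertMin k = trans (cong lengthToMax (entries-insertMin (x Vec.∷ τ) k))
    (lengthToMax-insertZeroAt (toℕ k) (toℕ x) (entries τ))

  mmpPerm-insertMin-suc : ∀ k → mmpPerm (insertMin (x Vec.∷ τ) (fsuc k)) ≡ mmpPerm (x Vec.∷ τ)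
  mmpPerm-insertMin-suc k = trans (cong mmp (entries-insertMin (x Vec.∷ τ) (fsuc k)))
    (mmp-insertZeroAt-suc (toℕ k) (entries (x Vec.∷ τ)))

  avoids-insertMin-zero : (mmpPerm (insertMin (x Vec.∷ τ) fzero) ≡ᵇ 0) ≡ (maxPosition (x Vec.∷ τ) ≤ᵇ 2)
  avoids-insertMin-zero = trans (cong (_≡ᵇ 0) (trans (cong mmp (entries-insertMin (x Vec.∷ τ) fzero))
    (mmp-insertZeroAt-zero (toℕ x) (entries τ))))
    (avoids (maxPosition (x Vec.∷ τ)) (lengthToMax≤2⇒mmp≡0 (entries (x Vec.∷ τ))))
    where
    avoids : ∀ t {r} → (t ≤ 2 → r ≡ 0) → ((ind (3 ≤ᵇ t) + r) ≡ᵇ 0) ≡ (t ≤ᵇ 2)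
    avoids 0                   r≡0 rewrite r≡0 z≤n               = refl
    avoids 1                   r≡0 rewrite r≡0 (s≤s z≤n)         = refl
    avoids 2                   r≡0 rewrite r≡0 (s≤s (s≤s z≤n))   = refl
    avoids (suc (suc (suc t))) _   = refl

R0-recurrence : ∀ m → R0 (suc (suc m)) ≡ 1 * maxInFirstTwo (suc m) + suc m * R0 (suc m)
R0-recurrence m = count-by-insertMin _ 1 (suc m) (λ τ → maxPosition τ ≤ᵇ 2) (λ τ → mmpPerm τ ≡ᵇ 0) pointwise
  where
  pointwise : ∀ τ → countB (λ k → mmpPerm (insertMin τ k) ≡ᵇ 0) (allFin (suc (suc m)))
                  ≡ 1 * ind (maxPosition τ ≤ᵇ 2) + suc m * ind (mmpPerm τ ≡ᵇ 0)
  pointwise (x Vec.∷ τ) = trans (countB-allFin-suc (λ k → mmpPerm (insertMin (x Vec.∷ τ) k) ≡ᵇ 0)) (cong₂ _+_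
    (trans (cong ind (avoids-insertMin-zero x τ)) (sym (*-identityˡ _)))
    (countB-allFin-const _ _ λ k → cong (_≡ᵇ 0) (mmpPerm-insertMin-suc x τ k)))

maxFirst-recurrence : ∀ m → maxFirst (suc (suc m)) ≡ suc m * maxFirst (suc m)
maxFirst-recurrence m = count-by-insertMin _ 0 (suc m) first first pointwise
  where
  first : Vec (Fin (suc m)) (suc m) → Bool
  first τ = maxPosition τ ≡ᵇ 1
  pointwise : ∀ τ → countB (λ k → maxPosition (insertMin τ k) ≡ᵇ 1) (allFin (suc (suc m)))
                  ≡ 0 * ind (first τ) + suc m * ind (first τ)
  pointwise (x Vec.∷ τ) = trans (countB-allFin-suc (λ k → maxPosition (insertMin (x Vec.∷ τ) k) ≡ᵇ 1)) (cong₂ _+_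
    (cong (λ t → ind (t ≡ᵇ 1)) (maxPosition-insertMin x τ fzero))
    (countB-allFin-const _ _ λ k →
      trans (cong (_≡ᵇ 1) (maxPosition-insertMin x τ (fsuc k))) (lengthAfterInsert-suc≡1 (toℕ k) (maxPosition (x Vec.∷ τ)) (s≤s z≤n))))

maxInFirstTwo-recurrence : ∀ m → maxInFirstTwo (suc (suc m)) ≡ 2 * maxFirst (suc m) + m * maxInFirstTwo (suc m)
maxInFirstTwo-recurrence m =
  count-by-insertMin _ 2 m (λ τ → maxPosition τ ≡ᵇ 1) (λ τ → maxPosition τ ≤ᵇ 2) pointwise
  where
  pointwise : ∀ τ → countB (λ k → maxPosition (insertMin τ k) ≤ᵇ 2) (allFin (suc (suc m)))
                  ≡ 2 * ind (maxPosition τ ≡ᵇ 1) + m * ind (maxPosition τ ≤ᵇ 2)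
  pointwise (x Vec.∷ τ) = begin
    countB (λ k → maxPosition (insertMin (x Vec.∷ τ) k) ≤ᵇ 2) (allFin (suc (suc m)))
      ≡⟨ countB-allFin-suc at ⟩
    ind (at fzero) + countB (at ∘ fsuc) (allFin (suc m))
      ≡⟨ cong (ind (at fzero) +_) (countB-allFin-suc (at ∘ fsuc)) ⟩
    ind (at fzero) + (ind (at (fsuc fzero)) + countB (at ∘ fsuc ∘ fsuc) (allFin m))
      ≡⟨ cong₂ (λ a b → ind a + (ind b + countB (at ∘ fsuc ∘ fsuc) (allFin m))) at-0 at-1 ⟩
    ind first + (ind first + countB (at ∘ fsuc ∘ fsuc) (allFin m))
      ≡⟨ cong (λ r → ind first + (ind first + r)) (countB-allFin-const _ _ at-2+) ⟩
    ind first + (ind first + m * ind early)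
      ≡⟨ cong (ind first +_) (+-assoc (ind first) 0 _) ⟨
    ind first + (ind first + 0 + m * ind early)
      ≡⟨ +-assoc (ind first) (ind first + 0) _ ⟨
    2 * ind first + m * ind early
      ∎
    where
    open ≡-Reasoning
    t = maxPosition (x Vec.∷ τ)
    first = t ≡ᵇ 1
    early = t ≤ᵇ 2
    at : Fin (suc (suc m)) → Bool
    at k = maxPosition (insertMin (x Vec.∷ τ) k) ≤ᵇ 2
    at-0 : at fzero ≡ first
    at-0 = trans (cong (_≤ᵇ 2) (maxPosition-insertMin x τ fzero)) (lengthAfterInsert-0≤2 t (s≤s z≤n))
    at-1 : at (fsuc fzero) ≡ first
    at-1 = trans (cong (_≤ᵇ 2) (maxPosition-insertMin x τ (fsuc fzero))) (lengthAfterInsert-1≤2 t (s≤s z≤n))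
    at-2+ : ∀ k → at (fsuc (fsuc k)) ≡ early
    at-2+ k = trans (cong (_≤ᵇ 2) (maxPosition-insertMin x τ (fsuc (fsuc k)))) (lengthAfterInsert-2+≤2 (toℕ k) t (s≤s z≤n))

maxFirst≡c1 : ∀ m → maxFirst (suc m) ≡ c (suc m) 1
maxFirst≡c1 zero    = refl
maxFirst≡c1 (suc m) = begin
  maxFirst (suc (suc m))      ≡⟨ maxFirst-recurrence m ⟩
  suc m * maxFirst (suc m)    ≡⟨ cong (suc m *_) (maxFirst≡c1 m) ⟩
  suc m * c (suc m) 1         ≡⟨ c-suc-1 m ⟨
  c (suc (suc m)) 1           ∎
  where open ≡-Reasoning

maxInFirstTwo≡2c1 : ∀ m → maxInFirstTwo (suc (suc m)) ≡ 2 * c (suc (suc m)) 1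
maxInFirstTwo≡2c1 zero    = refl
maxInFirstTwo≡2c1 (suc m) = begin
  maxInFirstTwo (suc (suc (suc m)))
    ≡⟨ maxInFirstTwo-recurrence (suc m) ⟩
  2 * maxFirst (suc (suc m)) + suc m * maxInFirstTwo (suc (suc m))
    ≡⟨ cong₂ (λ a b → 2 * a + suc m * b) (maxFirst≡c1 (suc m)) (maxInFirstTwo≡2c1 m) ⟩
  2 * c (suc (suc m)) 1 + suc m * (2 * c (suc (suc m)) 1)
    ≡⟨ regroup (c (suc (suc m)) 1) (suc m) ⟩
  2 * (suc (suc m) * c (suc (suc m)) 1)
    ≡⟨ cong (2 *_) (c-suc-1 (suc m)) ⟨
  2 * c (suc (suc (suc m))) 1
    ∎
  where
  open ≡-Reasoning
  regroup : ∀ a k → 2 * a + k * (2 * a) ≡ 2 * (suc k * a)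
  regroup = solve 2 (λ a k → con 2 :* a :+ k :* (con 2 :* a) := con 2 :* ((con 1 :+ k) :* a)) refl

R0≡2c2 : ∀ m → R0 (suc (suc m)) ≡ 2 * c (suc (suc m)) 2
R0≡2c2 zero    = refl
R0≡2c2 (suc m) = begin
  R0 (suc (suc (suc m)))
    ≡⟨ R0-recurrence (suc m) ⟩
  1 * maxInFirstTwo (suc (suc m)) + suc (suc m) * R0 (suc (suc m))
    ≡⟨ cong₂ (λ a b → 1 * a + suc (suc m) * b) (maxInFirstTwo≡2c1 m) (R0≡2c2 m) ⟩
  1 * (2 * c (suc (suc m)) 1) + suc (suc m) * (2 * c (suc (suc m)) 2)
    ≡⟨ regroup (c (suc (suc m)) 1) (c (suc (suc m)) 2) (suc (suc m)) ⟩
  2 * (c (suc (suc m)) 1 + suc (suc m) * c (suc (suc m)) 2)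
    ≡⟨ cong (2 *_) (c-suc-suc (suc (suc m)) 1) ⟨
  2 * c (suc (suc (suc m))) 2
    ∎
  where
  open ≡-Reasoning
  regroup : ∀ a b k → 1 * (2 * a) + k * (2 * b) ≡ 2 * (a + k * b)
  regroup = solve 3 (λ a b k → con 1 :* (con 2 :* a) :+ k :* (con 2 :* b) := con 2 :* (a :+ k :* b)) refl

mainTheorem13 : (n : ℕ) → 2 ≤ n → R0 n ≡ 2 * c n 2
mainTheorem13 (suc (suc m)) (s≤s (s≤s z≤n)) = R0≡2c2 m
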